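{- Let $M,N$ be finitary matroids on $E$, let $\mathcal{D}$ be a maximal $\trianglelefteq$-directed subset of $([\mathcal{I}_M\cap\mathcal{I}_N]^{<\aleph_0})/\!\sim$, let $x\in E\setminus\mathsf{span}_N(\mathcal{D})$, and let $I_x$ be a finite common independent set with $[I_x]\in\mathcal{D}$ such that there is no $[J]\in\mathcal{D}$ with $[J]\trianglerighteq[I_x]$ admitting an $x$-augmenting path for $J$. Then for every finite common independent set $I$ with $[I]\in\mathcal{D}$ and $[I]\trianglerighteq[I_x]$ we have $E(x,I)\subseteq\mathsf{span}_M(I\cap E(x,I))$.
   Context: Finitary matroids and $\mathsf{span}$ are as usual; $C_M(e,I)$ is the unique $M$-circuit in $I+e$ containing $e$. For $I\in\mathcal{I}_M\cap\mathcal{I}_N$, $D(I)$ is the digraph on $E$ with arcs: for $x\in E\setminus I$, $y\in I$, $xy$ is an arc if $x\in\mathsf{span}_M(I)$ and $y\in C_M(x,I)$, and $yx$ is an arc if $x\in\mathsf{span}_N(I)$ and $y\in C_N(x,I)$. $E(x,I)$ is the set of elements reachable from $x$ by a directed path in $D(I)$. An augmenting path for $I$ is a set $P=\{x_0,\dots,x_{2n}\}$ ($n\ge0$) with $x_0\notin\mathsf{span}_N(I)$, $x_{2n}\notin\mathsf{span}_M(I)$, $x_ix_{i+1}$ an arc of $D(I)$ for $i<2n$, and $x_ix_j$ not an arc whenever $i+1<j\le 2n$; it is $x$-augmenting if $x_0=x$. For finite common independent sets, $I\trianglelefteq J$ means $I\subseteq\mathsf{span}_M(J)\cap\mathsf{span}_N(J)$,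 $I\sim J$ means both $I\trianglelefteq J$ and $J\trianglelefteq I$, and $\trianglelefteq$ induces a partial order on the classes $[I]$. Directed: any two elements have an upper bound in the set. $\mathsf{span}_N(\mathcal{D}):=\bigcup_{[I]\in\mathcal{D}}\mathsf{span}_N(I)$. -}

module Defs where

open import Level using (0ℓ)
open import Data.Nat using (ℕ; suc; _*_; _<_)
open import Data.Fin using (Fin; zero; toℕ; inject₁; fromℕ) renaming (suc to fsuc)
open import Data.List using (List; length)
open import Data.List.Membership.Propositional using (_∈_)
open import Data.List.Relation.Unary.Unique.Propositional using (Unique)
open import Data.Product using (Σ; ∃; _×_)
open import Data.Sum using (_⊎_)
open import Data.Empty using (⊥)
open import Relation.Nullary using (¬_)
open import Relation.Unary using (Pred; _⊆_; _∩_)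
open import Relation.Binary.PropositionalEquality using (_≡_)
open import Relation.Binary.Construct.Closure.ReflexiveTransitive using (Star)

Subset : Set → Set₁
Subset E = Pred E 0ℓ

-- the set of elements of a list (finite subsets are given by lists)
set : {E : Set} → List E → Subset E
set L = λ e → e ∈ L

∅ : {E : Set} → Subset E
∅ = λ _ → ⊥

_+ₛ_ : {E : Set} → Subset E → E → Subset E
X +ₛ x = λ e → X e ⊎ e ≡ x

record FinitaryMatroid (E : Set) : Set₁ where
  field
    Ind        : Subset E → Set
    ind-∅      : Ind ∅
    ind-⊆      : {X Y : Subset E} → X ⊆ Y → Ind Y → Ind X
    finitary   : {X : Subset E} → ((L : List E) → set L ⊆ X → Ind (set L)) → Ind X
    augment    : (I J : List E) → Unique I → Unique J →
                 Ind (set I) → Ind (set J) → length I < length J →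
                 ∃ λ e → e ∈ J × ¬ (e ∈ I) × Ind (set I +ₛ e)

module _ {E : Set} (M : FinitaryMatroid E) where
  open FinitaryMatroid M

  span : Subset E → Subset E
  span X e = X e ⊎ ¬ Ind (X +ₛ e)

  -- finite circuits: minimal dependent finite sets (every proper subset,
  -- necessarily finite, is independent)
  IsCircuit : List E → Set
  IsCircuit C = ¬ Ind (set C) ×
    ((X : List E) → set X ⊆ set C → ¬ (set C ⊆ set X) → Ind (set X))

  -- y ∈ C_M(x, I): y lies in the (unique) circuit C ⊆ I + x with x ∈ C
  -- (for finite I such a circuit is finite)
  InFundCircuit : E → Subset E → E → Set
  InFundCircuit x I y = Σ (List E) λ C → IsCircuit C × set C ⊆ (I +ₛ x) × x ∈ C × y ∈ C

module _ {E : Set} (M N : FinitaryMatroid E) where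
  open FinitaryMatroid

  CommonInd : List E → Set
  CommonInd I = Ind M (set I) × Ind N (set I)

  _⊴_ : List E → List E → Set
  I ⊴ J = set I ⊆ (span M (set J) ∩ span N (set J))

  _∼_ : List E → List E → Set
  I ∼ J = (I ⊴ J) × (J ⊴ I)

  -- A set of ∼-classes of finite common independent sets is represented by
  -- the predicate on lists "the class of I belongs to the set", which is
  -- contained in CommonInd and saturated under ∼.
  IsClassSet : (List E → Set) → Set
  IsClassSet 𝒟 = ((I : List E) → 𝒟 I → CommonInd I) ×
                 ((I J : List E) → 𝒟 I → CommonInd J → I ∼ J → 𝒟 J)

  Directed : (List E → Set) → Set
  Directed 𝒟 = (I J : List E) → 𝒟 I → 𝒟 J →
               ∃ λ K → 𝒟 K × (I ⊴ K) × (J ⊴ K)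

  MaximalDirected : (List E → Set) → Set₁
  MaximalDirected 𝒟 = IsClassSet 𝒟 × Directed 𝒟 ×
    ((𝒟′ : List E → Set) → IsClassSet 𝒟′ → Directed 𝒟′ →
      ((I : List E) → 𝒟 I → 𝒟′ I) → (I : List E) → 𝒟′ I → 𝒟 I)

  spanN𝒟 : (List E → Set) → Subset E
  spanN𝒟 𝒟 e = ∃ λ I → 𝒟 I × span N (set I) e

  Arc : List E → E → E → Set
  Arc I a b =
    (¬ (a ∈ I) × b ∈ I × span M (set I) a × InFundCircuit M a (set I) b) ⊎
    (¬ (b ∈ I) × a ∈ I × span N (set I) b × InFundCircuit N b (set I) a)

  Reach : List E → E → E → Set
  Reach I x = Star (Arc I) x

  record AugPath (I : List E) (x : E) : Set where
    field
      n        : ℕ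
      p        : Fin (suc (2 * n)) → E
      start    : p zero ≡ x
      start∉   : ¬ span N (set I) (p zero)
      end∉     : ¬ span M (set I) (p (fromℕ (2 * n)))
      arcs     : (i : Fin (2 * n)) → Arc I (p (inject₁ i)) (p (fsuc i))
      noShort  : (i j : Fin (suc (2 * n))) → suc (toℕ i) < toℕ j → ¬ Arc I (p i) (p j)

-- If y ∉ span_M(I), repeatedly shortcutting a
-- walk from x to y yields a walk without chords; its arcs alternate between E ∖ I
-- and I, so its length is even and it is an x-augmenting path for I, which the
-- hypothesis excludes. If y ∈ span_M(I) ∖ I, every other element of the
-- fundamental circuit C_M(y, I) is the head of an arc leaving y, hence reachable
-- from x, so C_M(y, I) ⊆ (I ∩ E(x, I)) + y and y is spanned by I ∩ E(x, I).
module Submission where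

open import Defs
open import Level using (0ℓ)
open import Axiom.ExcludedMiddle using (ExcludedMiddle)
open import Axiom.DoubleNegationElimination using (em⇒dne)
open import Data.Nat using (ℕ; zero; suc; _+_; _*_; _∸_; _≤_; _<_; z≤n; s≤s)
open import Data.Nat.Properties
  using (≤-pred; +-suc; *-suc; +-monoˡ-≤; m+[n∸m]≡n; module ≤-Reasoning)
open import Data.Nat.Induction using (<-wellFounded)
open import Induction.WellFounded using (Acc; acc)
open import Data.Fin using (toℕ; inject₁; fromℕ)
open import Data.Fin.Properties using (toℕ-fromℕ; toℕ-inject₁; toℕ<n)
open import Data.List using (List; _∷_; length; filter)
open import Data.List.Properties using (filter-notAll)
open import Data.List.Membership.Propositional using (_∈_)
open import Data.List.Membership.Propositional.Properties using (∈-filter⁺; ∈-filter⁻)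
open import Data.List.Relation.Unary.Any as Any using (here; there)
open import Data.Product using (Σ; ∃; _×_; _,_; proj₁)
open import Data.Sum using (inj₁; inj₂)
open import Data.Empty using (⊥-elim)
open import Function using (_∘_)
open import Relation.Nullary using (¬_; yes; no; ¬?)
open import Relation.Unary using (_∩_; _⊆_)
open import Relation.Binary.PropositionalEquality using (_≡_; refl; sym; trans; cong; subst)
open import Relation.Binary.Construct.Closure.ReflexiveTransitive using (Star; ε; _◅_; _◅◅_)

module _ {E : Set} {R : E → E → Set} where

  steps : ∀ {a b} → Star R a b → ℕ
  steps ε       = 0
  steps (_ ◅ s) = suc (steps s)

  -- Past the end of the walk, vertex stays at its last vertex.
  vertex : ∀ {a b} → Star R a b → ℕ → E
  vertex {a} ε       _       = a
  vertex {a} (_ ◅ s) zero    = a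
  vertex     (_ ◅ s) (suc m) = vertex s m

  vertex-zero : ∀ {a b} (s : Star R a b) → vertex s 0 ≡ a
  vertex-zero ε       = refl
  vertex-zero (_ ◅ s) = refl

  vertex-steps : ∀ {a b} (s : Star R a b) → vertex s (steps s) ≡ b
  vertex-steps ε       = refl
  vertex-steps (_ ◅ s) = vertex-steps s

  vertex-step : ∀ {a b} (s : Star R a b) m → m < steps s → R (vertex s m) (vertex s (suc m))
  vertex-step (r ◅ s) zero    _   = subst (R _) (sym (vertex-zero s)) r
  vertex-step (_ ◅ s) (suc m) m<n = vertex-step s m (≤-pred m<n)

  take : ∀ {a b} (s : Star R a b) i → Star R a (vertex s i)
  take ε       _       = ε
  take (_ ◅ s) zero    = ε
  take (r ◅ s) (suc i) = r ◅ take s i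

  drop : ∀ {a b} (s : Star R a b) j → Star R (vertex s j) b
  drop ε       _       = ε
  drop (r ◅ s) zero    = r ◅ s
  drop (_ ◅ s) (suc j) = drop s j

  steps-take : ∀ {a b} (s : Star R a b) i → steps (take s i) ≤ i
  steps-take ε       _       = z≤n
  steps-take (_ ◅ s) zero    = z≤n
  steps-take (_ ◅ s) (suc i) = s≤s (steps-take s i)

  steps-drop : ∀ {a b} (s : Star R a b) j → steps (drop s j) ≡ steps s ∸ j
  steps-drop ε       zero    = refl
  steps-drop ε       (suc j) = refl
  steps-drop (_ ◅ s) zero    = refl
  steps-drop (_ ◅ s) (suc j) = steps-drop s j

  steps-◅◅ : ∀ {a b c} (s : Star R a b) (t : Star R b c) → steps (s ◅◅ t) ≡ steps s + steps t
  steps-◅◅ ε       t = refl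
  steps-◅◅ (_ ◅ s) t = cong suc (steps-◅◅ s t)

  Chord : ∀ {a b} → Star R a b → Set
  Chord s = ∃ λ i → ∃ λ j → suc i < j × j ≤ steps s × R (vertex s i) (vertex s j)

  Chordless : ∀ {a b} → Star R a b → Set
  Chordless s = ¬ Chord s

  shortcut : ∀ {a b} (s : Star R a b) → Chord s → Star R a b
  shortcut s (i , j , _ , _ , c) = take s i ◅◅ (c ◅ drop s j)

  steps-shortcut : ∀ {a b} (s : Star R a b) (chord : Chord s) →
                   steps (shortcut s chord) < steps s
  steps-shortcut s (i , j , i+1<j , j≤n , c) = begin
    suc (steps (take s i ◅◅ (c ◅ drop s j)))        ≡⟨ cong suc (steps-◅◅ (take s i) _) ⟩
    suc (steps (take s i) + suc (steps (drop s j))) ≡⟨ cong (λ k → suc (steps (take s i) + suc k)) (steps-drop s j) ⟩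
    suc (steps (take s i) + suc (steps s ∸ j))      ≤⟨ s≤s (+-monoˡ-≤ _ (steps-take s i)) ⟩
    suc (i + suc (steps s ∸ j))                     ≡⟨ cong suc (+-suc i _) ⟩
    suc (suc i) + (steps s ∸ j)                     ≤⟨ +-monoˡ-≤ _ i+1<j ⟩
    j + (steps s ∸ j)                               ≡⟨ m+[n∸m]≡n j≤n ⟩
    steps s                                         ∎
    where open ≤-Reasoning

  chordless-walk : ExcludedMiddle 0ℓ → ∀ {a b} → Star R a b → Σ (Star R a b) Chordless
  chordless-walk em s = go s (<-wellFounded (steps s))
    where
    go : ∀ {a b} (s : Star R a b) → Acc _<_ (steps s) → Σ (Star R a b) Chordless
    go s (acc shorter) with em {Chord s}
    ... | yes chord  = go (shortcut s chord) (shorter (steps-shortcut s chord))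
    ... | no  ¬chord = s , ¬chord

module _ {E : Set} (M : FinitaryMatroid E) where
  open FinitaryMatroid M

  ∷⊆+ₛ : ∀ {y} {I : List E} → set (y ∷ I) ⊆ set I +ₛ y
  ∷⊆+ₛ (here z≡y)  = inj₂ z≡y
  ∷⊆+ₛ (there z∈I) = inj₁ z∈I

  +ₛ⊆∷ : ∀ {y} {I : List E} → set I +ₛ y ⊆ set (y ∷ I)
  +ₛ⊆∷ (inj₁ z∈I) = there z∈I
  +ₛ⊆∷ (inj₂ z≡y) = here z≡y

  module _ (em : ExcludedMiddle 0ℓ) where

    private
      remove : E → List E → List E
      remove e = filter (λ z → ¬? (em {z ≡ e}))

      remove-⊆ : ∀ e L → set (remove e L) ⊆ set L
      remove-⊆ e L = proj₁ ∘ ∈-filter⁻ (λ z → ¬? (em {z ≡ e}))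

      remove-< : ∀ {e} L → e ∈ L → length (remove e L) < length L
      remove-< {e} L e∈L =
        filter-notAll (λ z → ¬? (em {z ≡ e})) L (Any.map (λ e≡z z≢e → z≢e (sym e≡z)) e∈L)

      ⊆-remove : ∀ {e} {L X : List E} → set X ⊆ set L → ¬ e ∈ X → set X ⊆ set (remove e L)
      ⊆-remove {e} X⊆L e∉X {z} z∈X =
        ∈-filter⁺ (λ z → ¬? (em {z ≡ e})) (X⊆L z∈X) (λ z≡e → e∉X (subst (_∈ _) z≡e z∈X))

      not-⊆-witness : {L X : List E} → ¬ (set L ⊆ set X) → ∃ λ e → e ∈ L × ¬ e ∈ X
      not-⊆-witness {L} {X} L⊈X with em {∃ λ e → e ∈ L × ¬ e ∈ X}
      ... | yes witness = witness
      ... | no  none    = ⊥-elim (L⊈X λ {e} e∈L → em⇒dne em λ e∉X → none (e , e∈L , e∉X))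

    -- If no single deletion keeps L dependent, L is itself a circuit.
    dependent⇒circuit : (L : List E) → ¬ Ind (set L) → ∃ λ C → IsCircuit M C × set C ⊆ set L
    dependent⇒circuit L = go L (<-wellFounded (length L))
      where
      go : (L : List E) → Acc _<_ (length L) → ¬ Ind (set L) → ∃ λ C → IsCircuit M C × set C ⊆ set L
      go L (acc shorter) dep with em {∃ λ e → e ∈ L × ¬ Ind (set (remove e L))}
      ... | yes (e , e∈L , dep′) =
        let C , circuit , C⊆ = go (remove e L) (shorter (remove-< L e∈L)) dep′
        in  C , circuit , remove-⊆ e L ∘ C⊆
      ... | no minimal = L , (dep , proper⇒ind) , λ z∈L → z∈L
        where
        proper⇒ind : (X : List E) → set X ⊆ set L → ¬ (set L ⊆ set X) → Ind (set X)
        proper⇒ind X X⊆L L⊈X =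
          let e , e∈L , e∉X = not-⊆-witness L⊈X
          in  ind-⊆ (⊆-remove X⊆L e∉X) (em⇒dne em λ dep′ → minimal (e , e∈L , dep′))

    fundamental-circuit : (I : List E) (y : E) → Ind (set I) → ¬ Ind (set I +ₛ y) →
                          ∃ λ C → IsCircuit M C × set C ⊆ set I +ₛ y × y ∈ C
    fundamental-circuit I y indI dep with dependent⇒circuit (y ∷ I) (dep ∘ ind-⊆ +ₛ⊆∷)
    ... | C , circuit , C⊆ = C , circuit , ∷⊆+ₛ ∘ C⊆ , y∈C
      where
      C⊆I : ¬ y ∈ C → set C ⊆ set I
      C⊆I y∉C z∈C with C⊆ z∈C
      ... | here refl = ⊥-elim (y∉C z∈C)
      ... | there z∈I = z∈I

      y∈C : y ∈ C
      y∈C = em⇒dne em λ y∉C → proj₁ circuit (ind-⊆ (C⊆I y∉C) indI)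

module _ {E : Set} (M N : FinitaryMatroid E) (I : List E) where

  arc-enters : ∀ {a b} → Arc M N I a b → ¬ a ∈ I → b ∈ I
  arc-enters (inj₁ (_ , b∈I , _)) _   = b∈I
  arc-enters (inj₂ (_ , a∈I , _)) a∉I = ⊥-elim (a∉I a∈I)

  arc-leaves : ∀ {a b} → Arc M N I a b → a ∈ I → ¬ b ∈ I
  arc-leaves (inj₁ (a∉I , _)) a∈I = ⊥-elim (a∉I a∈I)
  arc-leaves (inj₂ (b∉I , _)) _   = b∉I

  steps-even : ∀ {a b} (s : Star (Arc M N I) a b) → ¬ a ∈ I → ¬ b ∈ I → ∃ λ n → steps s ≡ 2 * n
  steps-even ε             _   _   = 0 , refl
  steps-even (r ◅ ε)       a∉I b∉I = ⊥-elim (b∉I (arc-enters r a∉I))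
  steps-even (r ◅ r′ ◅ s)  a∉I b∉I =
    let n , eq = steps-even s (arc-leaves r′ (arc-enters r a∉I)) b∉I
    in  suc n , trans (cong (2 +_) eq) (sym (*-suc 2 n))

  chordless⇒AugPath : ∀ {x y} (s : Star (Arc M N I) x y) → Chordless s →
                      ¬ span N (set I) x → ¬ span M (set I) y → AugPath M N I x
  chordless⇒AugPath {y = y} s chordless x∉span y∉span
    with steps-even s (x∉span ∘ inj₁) (y∉span ∘ inj₁)
  ... | n , steps≡ = record
    { n       = n
    ; p       = vertex s ∘ toℕ
    ; start   = vertex-zero s
    ; start∉  = x∉span ∘ subst (span N (set I)) (vertex-zero s)
    ; end∉    = y∉span ∘ subst (span M (set I)) last≡y
    ; arcs    = λ i → subst (λ k → Arc M N I (vertex s k) (vertex s (suc (toℕ i)))) (sym (toℕ-inject₁ i))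
                            (vertex-step s (toℕ i) (subst (toℕ i <_) (sym steps≡) (toℕ<n i)))
    ; noShort = λ i j i+1<j arc →
                  chordless (toℕ i , toℕ j , i+1<j , subst (toℕ j ≤_) (sym steps≡) (≤-pred (toℕ<n j)) , arc)
    }
    where
    last≡y : vertex s (toℕ (fromℕ (2 * n))) ≡ y
    last≡y = trans (cong (vertex s) (trans (toℕ-fromℕ (2 * n)) (sym steps≡))) (vertex-steps s)

  augmenting-path : ExcludedMiddle 0ℓ → ∀ {x y} → Reach M N I x y →
                    ¬ span N (set I) x → ¬ span M (set I) y → AugPath M N I x
  augmenting-path em x⇝y =
    let s , chordless = chordless-walk em x⇝y in chordless⇒AugPath s chordless

  span-∩-reach : ExcludedMiddle 0ℓ → FinitaryMatroid.Ind M (set I) → ∀ {x y} → Reach M N I x y →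
                 span M (set I) y → span M (set I ∩ Reach M N I x) y
  span-∩-reach em indI x⇝y (inj₁ y∈I) = inj₁ (y∈I , x⇝y)
  span-∩-reach em indI {x} {y} x⇝y (inj₂ dep) with em {y ∈ I}
  ... | yes y∈I = inj₁ (y∈I , x⇝y)
  ... | no  y∉I with fundamental-circuit M em I y indI dep
  ...   | C , circuit , C⊆I+y , y∈C = inj₂ (proj₁ circuit ∘ FinitaryMatroid.ind-⊆ M C⊆)
    where
    C⊆ : set C ⊆ (set I ∩ Reach M N I x) +ₛ y
    C⊆ {z} z∈C with C⊆I+y z∈C
    ... | inj₂ z≡y = inj₂ z≡y
    ... | inj₁ z∈I = inj₁ (z∈I , x⇝y ◅◅ (y→z ◅ ε))
      where
      y→z : Arc M N I y z
      y→z = inj₁ (y∉I , z∈I , inj₂ dep , C , circuit , C⊆I+y , y∈C , z∈C)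

lemma3p28 : ExcludedMiddle 0ℓ → {E : Set} (M N : FinitaryMatroid E) →
    (𝒟 : List E → Set) → MaximalDirected M N 𝒟 →
    (x : E) → ¬ spanN𝒟 M N 𝒟 x →
    (Iₓ : List E) → 𝒟 Iₓ →
    ¬ (∃ λ J → 𝒟 J × _⊴_ M N Iₓ J × AugPath M N J x) →
    (I : List E) → 𝒟 I → _⊴_ M N Iₓ I →
    (y : E) → Reach M N I x y →
    span M (set I ∩ (λ e → Reach M N I x e)) y
lemma3p28 em M N 𝒟 (classSet , _) x x∉span𝒟 Iₓ _ noAugPath I I∈𝒟 Iₓ⊴I y x⇝y
  with em {span M (set I) y}
... | yes y∈span = span-∩-reach M N I em (proj₁ (proj₁ classSet I I∈𝒟)) x⇝y y∈span
... | no  y∉span = ⊥-elim (noAugPath (I , I∈𝒟 , Iₓ⊴I , augmenting-path M N I em x⇝y x∉span y∉span))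
  where
  x∉span : ¬ span N (set I) x
  x∉span x∈span = x∉span𝒟 (I , I∈𝒟 , x∈span)
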